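{- For any $3$-uniform hypergraph $\mathcal{G}$ of girth at least $4$ without isolated vertices, and any word $p_\mathcal{G}$ constructed as below, $M_\mathcal{G}\not\models p_\mathcal{G}\approx p_\mathcal{G}^2$.
   Context: Girth is the length of a shortest cycle (a cycle being $v_0,e_0,\dots,v_{n-1},e_{n-1}$ with distinct vertices, distinct hyperedges and $v_{i+1}\in e_i\cap e_{i+1}$, indices mod $n$). For $\mathcal{G}=(V,E)$, take variables $y$ and $x_u$ ($u\in V$) and a finite sequence $\mathbf{w}_1,\dots,\mathbf{w}_n$ of words of the form $x_ux_vx_w$ such that: ($\alpha$) $x_ux_vx_w$ occurs in the list iff $\{u,v,w\}\in E$ (so all permutations occur; repetitions allowed); ($\beta$) for every pair of vertices $u,v$ (possibly $u=v$) there is $i\le n-1$ with $\mathbf{w}_i$ ending in $x_u$ and $\mathbf{w}_{i+1}$ starting with $x_v$; ($\gamma$) for every hyperedge $\{u,v,w\}$ and every vertex $u'\notin\{u,v,w\}$ there is $j$ with $\mathbf{w}_j=x_ux_vx_w$, $\mathbf{w}_{j-1}$ ending in $x_{u'}$ and $\mathbf{w}_{j+1}$ starting with $x_{u'}$. Then $p_\mathcal{G}=\prod_{1\le i\le n}(y\mathbf{w}_i)^2y$. For $2$-subsets of $V$, $\{u,v\}\equiv\{x,y\}$ iff there is $w$ with $\{u,v,w\},\{x,y,w\}\in E$, or neither is contained in a hyperedge. $M_\mathcal{G}$ is the monoid with identity $1$ generated by a zero $0$, an element $\mathsf{t}$ and the elements of $V$ subject to: $\mathsf{t}^2=\mathsf{t}u\mathsf{t}=\mathsf{t}uv\mathsf{t}=0$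 ($u,v\in V$); $uv=vu$; $uu=0$; $uv=0$ whenever no hyperedge contains $\{u,v\}$; $\mathsf{t}uvw\mathsf{t}=\mathsf{t}$ for $\{u,v,w\}\in E$; $uvw=u'v'w'$ for all $\{u,v,w\},\{u',v',w'\}\in E$ (this element is $\mathsf{e}$); $\mathsf{e}\mathsf{t}\mathsf{e}=\mathsf{e}$; and $uv=u'v'$ whenever $\{u,v\}\equiv\{u',v'\}$. -}

module Defs where

open import Data.Nat using (ℕ; zero; suc; _≤_; _∸_)
open import Data.Fin using (Fin; toℕ)
open import Data.Fin.Subset using (Subset; ⁅_⁆; _∪_; ∣_∣; _∈_; _∉_)
open import Data.Product using (Σ; _×_; _,_; ∃; ∃-syntax)
open import Data.Sum using (_⊎_)
open import Data.List using (List; []; _∷_; _++_; concat; concatMap; tabulate)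
open import Relation.Binary.PropositionalEquality using (_≡_; _≢_)
open import Relation.Nullary using (¬_)
open import Relation.Unary using (Decidable)
open import Function.Definitions using (Injective)
open import Function.Bundles using (_⇔_)

Edges : ℕ → Set₁
Edges k = Subset k → Set

⟦_,_,_⟧ : ∀ {k} → Fin k → Fin k → Fin k → Subset k
⟦ u , v , w ⟧ = ⁅ u ⁆ ∪ (⁅ v ⁆ ∪ ⁅ w ⁆)

ThreeUniform : ∀ {k} → Edges k → Set
ThreeUniform E = ∀ e → E e → ∣ e ∣ ≡ 3

NoIsolated : ∀ {k} → Edges k → Set
NoIsolated {k} E = ∀ (u : Fin k) → ∃[ e ] (E e × u ∈ e)

CycSucc : ∀ {n} → Fin n → Fin n → Set
CycSucc {n} i j = (toℕ j ≡ suc (toℕ i)) ⊎ ((toℕ i ≡ n ∸ 1) × (toℕ j ≡ 0))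

record Cycle {k} (E : Edges k) (n : ℕ) : Set where
  field
    two≤n    : 2 ≤ n
    vs       : Fin n → Fin k
    es       : Fin n → Subset k
    edges    : ∀ i → E (es i)
    vs-inj   : Injective _≡_ _≡_ vs
    es-inj   : Injective _≡_ _≡_ es
    incident : ∀ i j → CycSucc i j → (vs j ∈ es i) × (vs j ∈ es j)

GirthAtLeast4 : ∀ {k} → Edges k → Set
GirthAtLeast4 E = ∀ n → Cycle E n → 4 ≤ n

-- Words x_u x_v x_w, represented by triples (u , v , w)

Triple : ℕ → Set
Triple k = Fin k × Fin k × Fin k

first : ∀ {k} → Triple k → Fin k
first (u , _ , _) = u

last : ∀ {k} → Triple k → Fin k
last (_ , _ , w) = w

Consec : ∀ {n} → Fin n → Fin n → Set
Consec i j = toℕ j ≡ suc (toℕ i)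

CondAlpha : ∀ {k n} → Edges k → (Fin n → Triple k) → Set
CondAlpha {k} {n} E ws =
  ∀ (u v w : Fin k) → (∃[ i ] (ws i ≡ (u , v , w))) ⇔ E ⟦ u , v , w ⟧

CondBeta : ∀ {k n} → (Fin n → Triple k) → Set
CondBeta {k} {n} ws =
  ∀ (u v : Fin k) → ∃[ i ] ∃[ j ] (Consec i j × last (ws i) ≡ u × first (ws j) ≡ v)

CondGamma : ∀ {k n} → Edges k → (Fin n → Triple k) → Set
CondGamma {k} {n} E ws =
  ∀ (u v w u' : Fin k) → E ⟦ u , v , w ⟧ → u' ∉ ⟦ u , v , w ⟧ →
  ∃[ h ] ∃[ j ] ∃[ l ] (Consec h j × Consec j l × ws j ≡ (u , v , w)
                        × last (ws h) ≡ u' × first (ws l) ≡ u')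

data Var (k : ℕ) : Set where
  y : Var k
  x : Fin k → Var k

tword : ∀ {k} → Triple k → List (Var k)
tword (u , v , w) = x u ∷ x v ∷ x w ∷ []

pG : ∀ {k n} → (Fin n → Triple k) → List (Var k)
pG ws = concat (tabulate (λ i → (y ∷ tword (ws i)) ++ (y ∷ tword (ws i)))) ++ (y ∷ [])

-- The monoid M_G, presented as the free monoid on the generators
-- 0, t, (vertices) modulo the congruence generated by the relations.

data Gen (k : ℕ) : Set where
  𝟘 : Gen k
  t : Gen k
  vx : Fin k → Gen k

InEdge : ∀ {k} → Edges k → Fin k → Fin k → Set
InEdge E u v = ∃[ e ] (E e × u ∈ e × v ∈ e)

PairEquiv : ∀ {k} → Edges k → Fin k → Fin k → Fin k → Fin k → Set
PairEquiv E u v u' v' =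
  (∃[ w ] (E ⟦ u , v , w ⟧ × E ⟦ u' , v' , w ⟧))
  ⊎ (¬ InEdge E u v × ¬ InEdge E u' v')

data Rel {k} (E : Edges k) : List (Gen k) → List (Gen k) → Set where
  zeroˡ   : ∀ g → Rel E (𝟘 ∷ g ∷ []) (𝟘 ∷ [])
  zeroʳ   : ∀ g → Rel E (g ∷ 𝟘 ∷ []) (𝟘 ∷ [])
  tt      : Rel E (t ∷ t ∷ []) (𝟘 ∷ [])
  tut     : ∀ u → Rel E (t ∷ vx u ∷ t ∷ []) (𝟘 ∷ [])
  tuvt    : ∀ u v → Rel E (t ∷ vx u ∷ vx v ∷ t ∷ []) (𝟘 ∷ [])
  comm    : ∀ u v → Rel E (vx u ∷ vx v ∷ []) (vx v ∷ vx u ∷ [])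
  sq      : ∀ u → Rel E (vx u ∷ vx u ∷ []) (𝟘 ∷ [])
  noedge  : ∀ u v → ¬ InEdge E u v → Rel E (vx u ∷ vx v ∷ []) (𝟘 ∷ [])
  tuvwt   : ∀ u v w → E ⟦ u , v , w ⟧ →
            Rel E (t ∷ vx u ∷ vx v ∷ vx w ∷ t ∷ []) (t ∷ [])
  edgeEq  : ∀ u v w u' v' w' → E ⟦ u , v , w ⟧ → E ⟦ u' , v' , w' ⟧ →
            Rel E (vx u ∷ vx v ∷ vx w ∷ []) (vx u' ∷ vx v' ∷ vx w' ∷ [])
  ete     : ∀ u v w → E ⟦ u , v , w ⟧ →
            Rel E (vx u ∷ vx v ∷ vx w ∷ t ∷ vx u ∷ vx v ∷ vx w ∷ [])
                  (vx u ∷ vx v ∷ vx w ∷ [])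
  pairEq  : ∀ u v u' v' → u ≢ v → u' ≢ v' → PairEquiv E u v u' v' →
            Rel E (vx u ∷ vx v ∷ []) (vx u' ∷ vx v' ∷ [])

data Cong {k} (E : Edges k) : List (Gen k) → List (Gen k) → Set where
  step  : ∀ p q {l r} → Rel E l r → Cong E (p ++ l ++ q) (p ++ r ++ q)
  refl  : ∀ {a} → Cong E a a
  sym   : ∀ {a b} → Cong E a b → Cong E b a
  trans : ∀ {a b c} → Cong E a b → Cong E b c → Cong E a c

eval : ∀ {k} → (Var k → List (Gen k)) → List (Var k) → List (Gen k)
eval φ w = concatMap φ w

Satisfies : ∀ {k} → Edges k → List (Var k) → List (Var k) → Set
Satisfies E p q = ∀ φ → Cong E (eval φ p) (eval φ q)

-- Under y ↦ t, x_u ↦ u every word w_i evaluates to e, and t e t = t, so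
-- p_G evaluates to t, whereas p_G² evaluates to t·t = 0 because p_G begins
-- with y.  It remains to see that t ≠ 0 in M_G, which is witnessed by the
-- right action of M_G on the right ideal e M_G = {0, e, e t, e t u, e t u v}.
-- Girth at least 4 means that two vertices lie in at most one hyperedge, so
-- a nonzero product uv is determined by the vertex w completing {u,v} to a
-- hyperedge; the relation {u,v} ≡ {u',v'} identifies exactly the pairs with
-- the same completing vertex (or with none).
module Submission where

open import Defs
open import Data.Empty using (⊥-elim)
open import Data.Fin using (Fin; zero; suc) renaming (_≟_ to _≟ᶠ_)
open import Data.Fin.Properties using (any?)
open import Data.Fin.Subset using (Subset; ⁅_⁆; _∪_; ∣_∣; _∈_; inside; outside)
open import Data.Fin.Subset.Properties
  using (x∈⁅x⁆; x∈⁅y⁆⇒x≡y; x∈p∪q⁻; x∈p∪q⁺; ∪-assoc; ∪-comm; ∪-idem; ∣⁅x⁆∣≡1)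
open import Data.List using (List; []; _∷_; _++_; foldl; concat; tabulate; drop)
open import Data.List.Properties using (foldl-++; concatMap-++)
open import Data.Maybe using (Maybe; just; nothing; _>>=_; map)
open import Data.Nat using (ℕ; zero; suc; _≤_; _+_; z≤n; s≤s)
open import Data.Nat.Properties using (≤-trans; +-monoʳ-≤; n≤1+n; +-suc)
open import Data.Product using (_×_; _,_)
open import Data.Sum using (_⊎_; inj₁; inj₂)
open import Data.Vec using ([]; _∷_)
open import Function using (_∘_; _$_)
open import Function.Bundles using (Equivalence)
open import Function.Definitions using (Injective)
open import Relation.Binary.PropositionalEquality using (_≡_; _≢_; refl; cong; subst)
import Relation.Binary.PropositionalEquality as ≡
open import Relation.Nullary using (¬_; yes; no; contradiction)
open import Relation.Unary using (Decidable)

open ≡.≡-Reasoning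

∣p∪q∣≤∣p∣+∣q∣ : ∀ {n} (p q : Subset n) → ∣ p ∪ q ∣ ≤ ∣ p ∣ + ∣ q ∣
∣p∪q∣≤∣p∣+∣q∣ [] [] = z≤n
∣p∪q∣≤∣p∣+∣q∣ (inside ∷ p) (inside ∷ q) =
  s≤s (≤-trans (∣p∪q∣≤∣p∣+∣q∣ p q) (+-monoʳ-≤ ∣ p ∣ (n≤1+n ∣ q ∣)))
∣p∪q∣≤∣p∣+∣q∣ (inside ∷ p) (outside ∷ q) = s≤s (∣p∪q∣≤∣p∣+∣q∣ p q)
∣p∪q∣≤∣p∣+∣q∣ (outside ∷ p) (inside ∷ q) rewrite +-suc ∣ p ∣ ∣ q ∣ = s≤s (∣p∪q∣≤∣p∣+∣q∣ p q)
∣p∪q∣≤∣p∣+∣q∣ (outside ∷ p) (outside ∷ q) = ∣p∪q∣≤∣p∣+∣q∣ p q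

fin2-injective : ∀ {A : Set} {f : Fin 2 → A} → f zero ≢ f (suc zero) → Injective _≡_ _≡_ f
fin2-injective f0≢f1 {zero}     {zero}     _  = refl
fin2-injective f0≢f1 {zero}     {suc zero} eq = ⊥-elim (f0≢f1 eq)
fin2-injective f0≢f1 {suc zero} {zero}     eq = ⊥-elim (f0≢f1 (≡.sym eq))
fin2-injective f0≢f1 {suc zero} {suc zero} _  = refl

module _ {k : ℕ} where

  private variable
    a u v w w' z : Fin k

  u∈⟦u,v,w⟧ : u ∈ ⟦ u , v , w ⟧
  u∈⟦u,v,w⟧ {u} = x∈p∪q⁺ (inj₁ (x∈⁅x⁆ u))

  v∈⟦u,v,w⟧ : v ∈ ⟦ u , v , w ⟧
  v∈⟦u,v,w⟧ {v} {u} = x∈p∪q⁺ {p = ⁅ u ⁆} (inj₂ (x∈p∪q⁺ (inj₁ (x∈⁅x⁆ v))))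

  w∈⟦u,v,w⟧ : w ∈ ⟦ u , v , w ⟧
  w∈⟦u,v,w⟧ {w} {u} {v} = x∈p∪q⁺ {p = ⁅ u ⁆} (inj₂ (x∈p∪q⁺ {p = ⁅ v ⁆} (inj₂ (x∈⁅x⁆ w))))

  ∈⟦u,v,w⟧⁻ : z ∈ ⟦ u , v , w ⟧ → z ≡ u ⊎ z ≡ v ⊎ z ≡ w
  ∈⟦u,v,w⟧⁻ {u = u} {v} {w} x∈ with x∈p∪q⁻ ⁅ u ⁆ _ x∈
  ... | inj₁ x∈u = inj₁ (x∈⁅y⁆⇒x≡y u x∈u)
  ... | inj₂ x∈vw with x∈p∪q⁻ ⁅ v ⁆ ⁅ w ⁆ x∈vw
  ...   | inj₁ x∈v = inj₂ (inj₁ (x∈⁅y⁆⇒x≡y v x∈v))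
  ...   | inj₂ x∈w = inj₂ (inj₂ (x∈⁅y⁆⇒x≡y w x∈w))

  ⟦u,v,w⟧≡⟦v,u,w⟧ : ⟦ u , v , w ⟧ ≡ ⟦ v , u , w ⟧
  ⟦u,v,w⟧≡⟦v,u,w⟧ {u} {v} {w} = begin
    ⁅ u ⁆ ∪ (⁅ v ⁆ ∪ ⁅ w ⁆) ≡⟨ ∪-assoc ⁅ u ⁆ ⁅ v ⁆ ⁅ w ⁆ ⟨
    (⁅ u ⁆ ∪ ⁅ v ⁆) ∪ ⁅ w ⁆ ≡⟨ cong (_∪ ⁅ w ⁆) (∪-comm ⁅ u ⁆ ⁅ v ⁆) ⟩
    (⁅ v ⁆ ∪ ⁅ u ⁆) ∪ ⁅ w ⁆ ≡⟨ ∪-assoc ⁅ v ⁆ ⁅ u ⁆ ⁅ w ⁆ ⟩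
    ⁅ v ⁆ ∪ (⁅ u ⁆ ∪ ⁅ w ⁆) ∎

  ⟦u,v,w⟧≡⟦u,w,v⟧ : ⟦ u , v , w ⟧ ≡ ⟦ u , w , v ⟧
  ⟦u,v,w⟧≡⟦u,w,v⟧ {u} {v} {w} = cong (⁅ u ⁆ ∪_) (∪-comm ⁅ v ⁆ ⁅ w ⁆)

  ∣⟦u,u,w⟧∣≤2 : ∣ ⟦ u , u , w ⟧ ∣ ≤ 2
  ∣⟦u,u,w⟧∣≤2 {u} {w} rewrite ≡.sym (∪-assoc ⁅ u ⁆ ⁅ u ⁆ ⁅ w ⁆) | ∪-idem ⁅ u ⁆ =
    subst (∣ ⁅ u ⁆ ∪ ⁅ w ⁆ ∣ ≤_) (≡.cong₂ _+_ (∣⁅x⁆∣≡1 u) (∣⁅x⁆∣≡1 w)) (∣p∪q∣≤∣p∣+∣q∣ ⁅ u ⁆ ⁅ w ⁆)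

  module HyperedgeProperties (E : Edges k) where

    edge-swap₁₂ : E ⟦ u , v , w ⟧ → E ⟦ v , u , w ⟧
    edge-swap₁₂ = subst E ⟦u,v,w⟧≡⟦v,u,w⟧

    edge-swap₂₃ : E ⟦ u , v , w ⟧ → E ⟦ u , w , v ⟧
    edge-swap₂₃ = subst E ⟦u,v,w⟧≡⟦u,w,v⟧

    edge-rotate : E ⟦ u , v , w ⟧ → E ⟦ v , w , u ⟧
    edge-rotate = edge-swap₂₃ ∘ edge-swap₁₂

    edge-rotate⁻¹ : E ⟦ v , w , u ⟧ → E ⟦ u , v , w ⟧
    edge-rotate⁻¹ = edge-swap₁₂ ∘ edge-swap₂₃

    ThreeUniform⇒u≢v : ThreeUniform E → E ⟦ u , v , w ⟧ → u ≢ v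
    ThreeUniform⇒u≢v {u} {w = w} uniform uvw refl with subst (_≤ 2) (uniform _ uvw) (∣⟦u,u,w⟧∣≤2 {u} {w})
    ... | s≤s (s≤s ())

    Cycle₂ : ∀ {e₁ e₂} → u ≢ v → e₁ ≢ e₂ → E e₁ → E e₂ →
             u ∈ e₁ → v ∈ e₁ → u ∈ e₂ → v ∈ e₂ → Cycle E 2
    Cycle₂ {u} {v} {e₁} {e₂} u≢v e₁≢e₂ Ee₁ Ee₂ u∈e₁ v∈e₁ u∈e₂ v∈e₂ = record
      { two≤n    = s≤s (s≤s z≤n)
      ; vs       = vs
      ; es       = es
      ; edges    = λ { zero → Ee₁ ; (suc zero) → Ee₂ }
      ; vs-inj   = fin2-injective u≢v
      ; es-inj   = fin2-injective e₁≢e₂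
      ; incident = incident
      }
      where
      vs : Fin 2 → Fin k
      vs zero       = u
      vs (suc zero) = v
      es : Fin 2 → Subset k
      es zero       = e₁
      es (suc zero) = e₂
      incident : ∀ i j → CycSucc i j → (vs j ∈ es i) × (vs j ∈ es j)
      incident zero       zero       (inj₁ ())
      incident zero       zero       (inj₂ (() , _))
      incident zero       (suc zero) _ = v∈e₁ , v∈e₂
      incident (suc zero) zero       _ = u∈e₂ , u∈e₁
      incident (suc zero) (suc zero) (inj₁ ())
      incident (suc zero) (suc zero) (inj₂ (_ , ()))

    girth≥4⇒third-unique : ThreeUniform E → GirthAtLeast4 E →
                           E ⟦ a , u , w ⟧ → E ⟦ a , u , w' ⟧ → w ≡ w'
    girth≥4⇒third-unique {a} {u} {w} {w'} uniform girth auw auw' with w ≟ᶠ w'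
    ... | yes w≡w' = w≡w'
    ... | no w≢w' with girth 2 (Cycle₂ (ThreeUniform⇒u≢v uniform auw) edges-differ
                                  auw auw' u∈⟦u,v,w⟧ v∈⟦u,v,w⟧ u∈⟦u,v,w⟧ v∈⟦u,v,w⟧)
      where
      edges-differ : ⟦ a , u , w ⟧ ≢ ⟦ a , u , w' ⟧
      edges-differ eq with ∈⟦u,v,w⟧⁻ (subst (w' ∈_) (≡.sym eq) w∈⟦u,v,w⟧)
      ... | inj₁ w'≡a        = ThreeUniform⇒u≢v uniform (edge-swap₂₃ auw') (≡.sym w'≡a)
      ... | inj₂ (inj₁ w'≡u) = ThreeUniform⇒u≢v uniform (edge-rotate auw') (≡.sym w'≡u)
      ... | inj₂ (inj₂ w'≡w) = w≢w' (≡.sym w'≡w)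
    ...   | s≤s (s≤s ())

module _ {k : ℕ} {E : Edges k} {A : Set} (_∙_ : A → Gen k → A)
         (∙-resp-Rel : ∀ {l r} → Rel E l r → ∀ s → foldl _∙_ s l ≡ foldl _∙_ s r) where

  foldl-resp-Cong : ∀ {l r} → Cong E l r → ∀ s → foldl _∙_ s l ≡ foldl _∙_ s r
  foldl-resp-Cong (step p q {l} {r} ρ) s = begin
    foldl _∙_ s (p ++ l ++ q)                   ≡⟨ split l ⟩
    foldl _∙_ (foldl _∙_ (foldl _∙_ s p) l) q   ≡⟨ cong (λ s' → foldl _∙_ s' q) (∙-resp-Rel ρ _) ⟩
    foldl _∙_ (foldl _∙_ (foldl _∙_ s p) r) q   ≡⟨ split r ⟨
    foldl _∙_ s (p ++ r ++ q)                   ∎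
    where
    split : ∀ m → foldl _∙_ s (p ++ m ++ q) ≡ foldl _∙_ (foldl _∙_ (foldl _∙_ s p) m) q
    split m = ≡.trans (foldl-++ _∙_ s p (m ++ q)) (foldl-++ _∙_ (foldl _∙_ s p) m q)
  foldl-resp-Cong refl        s = refl
  foldl-resp-Cong (sym c)     s = ≡.sym (foldl-resp-Cong c s)
  foldl-resp-Cong (trans c d) s = ≡.trans (foldl-resp-Cong c s) (foldl-resp-Cong d s)

σ : ∀ {k} → Var k → List (Gen k)
σ y     = t ∷ []
σ (x u) = vx u ∷ []

edgeOf : ∀ {k} → Triple k → Subset k
edgeOf (u , v , w) = ⟦ u , v , w ⟧

block : ∀ {k} → Triple k → List (Var k)
block tr = (y ∷ tword tr) ++ (y ∷ tword tr)

pG-blocks : ∀ {k n} → (Fin n → Triple k) → List (Var k)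
pG-blocks ws = concat (tabulate (block ∘ ws))

module RightIdeal {k : ℕ} (E : Edges k) (E? : Decidable E)
  (distinct     : ∀ {u v w} → E ⟦ u , v , w ⟧ → u ≢ v)
  (third-unique : ∀ {a u w w'} → E ⟦ a , u , w ⟧ → E ⟦ a , u , w' ⟧ → w ≡ w') where

  open HyperedgeProperties E using (edge-swap₁₂; edge-rotate; edge-rotate⁻¹)

  private variable
    a u v w u' v' : Fin k

  third : Fin k → Fin k → Maybe (Fin k)
  third a u with any? (λ w → E? ⟦ a , u , w ⟧)
  ... | yes (w , _) = just w
  ... | no _        = nothing

  third-sound : third a u ≡ just w → E ⟦ a , u , w ⟧
  third-sound {a} {u} eq with any? (λ w → E? ⟦ a , u , w ⟧) | eq
  ... | yes (_ , auw) | refl = auw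
  ... | no _          | ()

  third-complete : E ⟦ a , u , w ⟧ → third a u ≡ just w
  third-complete {a} {u} auw with any? (λ w → E? ⟦ a , u , w ⟧)
  ... | yes (_ , auw') = cong just (third-unique auw' auw)
  ... | no none        = ⊥-elim (none (_ , auw))

  third-cong : (∀ {w} → E ⟦ u , v , w ⟧ → E ⟦ u' , v' , w ⟧) →
               (∀ {w} → E ⟦ u' , v' , w ⟧ → E ⟦ u , v , w ⟧) → third u v ≡ third u' v'
  third-cong {u} {v} {u'} {v'} to from with third u v in eq
  ... | just w = ≡.sym (third-complete (to (third-sound eq)))
  ... | nothing with third u' v' in eq'
  ...   | nothing = refl
  ...   | just w  with () ← ≡.trans (≡.sym eq) (third-complete (from (third-sound eq')))

  third-comm : third u v ≡ third v u
  third-comm = third-cong edge-swap₁₂ edge-swap₁₂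

  third-diag : third u u ≡ nothing
  third-diag {u} with third u u in eq
  ... | nothing = refl
  ... | just w  = contradiction refl (distinct (third-sound eq))

  third-noEdge : ¬ InEdge E u v → third u v ≡ nothing
  third-noEdge {u} {v} ¬uv with third u v in eq
  ... | nothing = refl
  ... | just w  = contradiction (_ , third-sound eq , u∈⟦u,v,w⟧ , v∈⟦u,v,w⟧) ¬uv

  third-PairEquiv : PairEquiv E u v u' v' → third u v ≡ third u' v'
  third-PairEquiv (inj₁ (w , uvw , u'v'w)) = ≡.trans (third-complete uvw) (≡.sym (third-complete u'v'w))
  third-PairEquiv (inj₂ (¬uv , ¬u'v'))     = ≡.trans (third-noEdge ¬uv) (≡.sym (third-noEdge ¬u'v'))

  -- etuv w stands for e t u v with {u,v,w} ∈ E; nothing stands for 0.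
  data Ideal : Set where
    e et : Ideal
    etu etuv : Fin k → Ideal

  infixl 5 _◃_ _◃ᵖ_ _·_

  _◃_ : Ideal → Fin k → Maybe Ideal
  e      ◃ u = nothing
  et     ◃ u = just (etu u)
  etu a  ◃ u = map etuv (third a u)
  etuv w ◃ u with u ≟ᶠ w
  ... | yes _ = just e
  ... | no _  = nothing

  _·_ : Ideal → Gen k → Maybe Ideal
  i      · 𝟘    = nothing
  i      · vx u = i ◃ u
  e      · t    = just et
  et     · t    = nothing
  etu _  · t    = nothing
  etuv _ · t    = nothing

  _∙_ : Maybe Ideal → Gen k → Maybe Ideal
  m ∙ g = m >>= (_· g)

  act : Maybe Ideal → List (Gen k) → Maybe Ideal
  act = foldl _∙_

  act-nothing : ∀ gs → act nothing gs ≡ nothing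
  act-nothing []       = refl
  act-nothing (_ ∷ gs) = act-nothing gs

  etuv◃-self : etuv w ◃ w ≡ just e
  etuv◃-self {w} with w ≟ᶠ w
  ... | yes _   = refl
  ... | no w≢w  = contradiction refl w≢w

  etuv◃-other : v ≢ w → etuv w ◃ v ≡ nothing
  etuv◃-other {v} {w} v≢w with v ≟ᶠ w
  ... | yes v≡w = contradiction v≡w v≢w
  ... | no _    = refl

  closes : Fin k → Fin k → Fin k → Maybe Ideal
  closes a u v with E? ⟦ a , u , v ⟧
  ... | yes _ = just e
  ... | no _  = nothing

  third-closes : ∀ a u v → (map etuv (third a u) >>= (_◃ v)) ≡ closes a u v
  third-closes a u v with E? ⟦ a , u , v ⟧
  ... | yes auv rewrite third-complete auv = etuv◃-self
  ... | no ¬auv with third a u in eq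
  ...   | nothing = refl
  ...   | just w  = etuv◃-other λ { refl → ¬auv (third-sound eq) }

  closes-rotate : ∀ a u v → closes a u v ≡ closes u v a
  closes-rotate a u v with E? ⟦ a , u , v ⟧ | E? ⟦ u , v , a ⟧
  ... | yes _   | yes _   = refl
  ... | no _    | no _    = refl
  ... | yes auv | no ¬uva = contradiction (edge-rotate auv) ¬uva
  ... | no ¬auv | yes uva = contradiction (edge-rotate⁻¹ uva) ¬auv

  -- The action of a product uv, through its completing vertex third u v;
  -- on etu a it uses e t a u v = e t u v a.
  _◃ᵖ_ : Ideal → Maybe (Fin k) → Maybe Ideal
  e      ◃ᵖ _ = nothing
  et     ◃ᵖ m = map etuv m
  etu a  ◃ᵖ m = map etuv m >>= (_◃ a)
  etuv _ ◃ᵖ _ = nothing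

  ◃ᵖ-nothing : ∀ i → i ◃ᵖ nothing ≡ nothing
  ◃ᵖ-nothing e        = refl
  ◃ᵖ-nothing et       = refl
  ◃ᵖ-nothing (etu _)  = refl
  ◃ᵖ-nothing (etuv _) = refl

  ◃◃≡◃ᵖ-third : ∀ i u v → act (just i) (vx u ∷ vx v ∷ []) ≡ i ◃ᵖ third u v
  ◃◃≡◃ᵖ-third e        u v = refl
  ◃◃≡◃ᵖ-third et       u v = refl
  ◃◃≡◃ᵖ-third (etu a)  u v = begin
    (map etuv (third a u) >>= (_◃ v)) ≡⟨ third-closes a u v ⟩
    closes a u v                      ≡⟨ closes-rotate a u v ⟩
    closes u v a                      ≡⟨ third-closes u v a ⟨
    (map etuv (third u v) >>= (_◃ a)) ∎
  ◃◃≡◃ᵖ-third (etuv w) u v with u ≟ᶠ w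
  ... | yes _ = refl
  ... | no _  = refl

  pair-resp : third u v ≡ third u' v' → ∀ i →
              act (just i) (vx u ∷ vx v ∷ []) ≡ act (just i) (vx u' ∷ vx v' ∷ [])
  pair-resp {u} {v} {u'} {v'} eq i =
    ≡.trans (◃◃≡◃ᵖ-third i u v) (≡.trans (cong (i ◃ᵖ_) eq) (≡.sym (◃◃≡◃ᵖ-third i u' v')))

  pair-zero : third u v ≡ nothing → ∀ i → act (just i) (vx u ∷ vx v ∷ []) ≡ nothing
  pair-zero {u} {v} eq i = ≡.trans (◃◃≡◃ᵖ-third i u v) (≡.trans (cong (i ◃ᵖ_) eq) (◃ᵖ-nothing i))

  times-e : Ideal → Maybe Ideal
  times-e et = just e
  times-e _  = nothing

  ◃ᵖ-edge : ∀ i w → (i ◃ᵖ just w >>= (_◃ w)) ≡ times-e i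
  ◃ᵖ-edge e        w = refl
  ◃ᵖ-edge et       w = etuv◃-self
  ◃ᵖ-edge (etu a)  w with a ≟ᶠ w
  ... | yes _ = refl
  ... | no _  = refl
  ◃ᵖ-edge (etuv _) w = refl

  edge-act : E ⟦ u , v , w ⟧ → ∀ i → act (just i) (vx u ∷ vx v ∷ vx w ∷ []) ≡ times-e i
  edge-act {u} {v} {w} uvw i = begin
    (act (just i) (vx u ∷ vx v ∷ []) >>= (_◃ w)) ≡⟨ cong (_>>= (_◃ w)) (◃◃≡◃ᵖ-third i u v) ⟩
    (i ◃ᵖ third u v >>= (_◃ w))                  ≡⟨ cong (λ m → i ◃ᵖ m >>= (_◃ w)) (third-complete uvw) ⟩
    (i ◃ᵖ just w >>= (_◃ w))                     ≡⟨ ◃ᵖ-edge i w ⟩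
    times-e i                                    ∎

  t∷-act : ∀ i → (∀ gs → act (just i) (t ∷ gs) ≡ act (just et) gs)
                ⊎ (∀ gs → act (just i) (t ∷ gs) ≡ nothing)
  t∷-act e        = inj₁ λ _ → refl
  t∷-act et       = inj₂ act-nothing
  t∷-act (etu _)  = inj₂ act-nothing
  t∷-act (etuv _) = inj₂ act-nothing

  t∷-resp : ∀ {l r} → act (just et) l ≡ act (just et) r →
            ∀ i → act (just i) (t ∷ l) ≡ act (just i) (t ∷ r)
  t∷-resp {l} {r} eq i with t∷-act i
  ... | inj₁ via-et = ≡.trans (via-et l) (≡.trans eq (≡.sym (via-et r)))
  ... | inj₂ killed = ≡.trans (killed l) (≡.sym (killed r))

  t∷-zero : ∀ {l} → act (just et) l ≡ nothing → ∀ i → act (just i) (t ∷ l) ≡ nothing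
  t∷-zero {l} eq i with t∷-act i
  ... | inj₁ via-et = ≡.trans (via-et l) eq
  ... | inj₂ killed = killed l

  act-just-resp-Rel : ∀ {l r} → Rel E l r → ∀ i → act (just i) l ≡ act (just i) r
  act-just-resp-Rel (zeroˡ _) i = refl
  act-just-resp-Rel (zeroʳ g) i with i · g
  ... | just _  = refl
  ... | nothing = refl
  act-just-resp-Rel tt         = t∷-zero {t ∷ []} refl
  act-just-resp-Rel (tut u)    = t∷-zero {vx u ∷ t ∷ []} refl
  act-just-resp-Rel (tuvt u v) = t∷-zero {vx u ∷ vx v ∷ t ∷ []} (pair-then-t (third u v))
    where
    pair-then-t : ∀ m → (map etuv m >>= (_· t)) ≡ nothing
    pair-then-t nothing  = refl
    pair-then-t (just _) = refl
  act-just-resp-Rel (tuvwt u v w uvw) =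
    t∷-resp {vx u ∷ vx v ∷ vx w ∷ t ∷ []} {[]} (cong (_>>= (_· t)) (edge-act uvw et))
  act-just-resp-Rel (comm _ _)       = pair-resp third-comm
  act-just-resp-Rel (sq _)           = pair-zero third-diag
  act-just-resp-Rel (noedge _ _ ¬uv) = pair-zero (third-noEdge ¬uv)
  act-just-resp-Rel (edgeEq _ _ _ _ _ _ uvw u'v'w') i =
    ≡.trans (edge-act uvw i) (≡.sym (edge-act u'v'w' i))
  act-just-resp-Rel (ete u v w uvw) i = begin
    act (act (just i) uvw-word) (t ∷ uvw-word) ≡⟨ cong (λ m → act m (t ∷ uvw-word)) (edge-act uvw i) ⟩
    act (times-e i) (t ∷ uvw-word)             ≡⟨ e-t-e i ⟩
    times-e i                                  ≡⟨ edge-act uvw i ⟨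
    act (just i) uvw-word                      ∎
    where
    uvw-word : List (Gen k)
    uvw-word = vx u ∷ vx v ∷ vx w ∷ []
    e-t-e : ∀ i → act (times-e i) (t ∷ uvw-word) ≡ times-e i
    e-t-e e        = refl
    e-t-e et       = edge-act uvw et
    e-t-e (etu _)  = refl
    e-t-e (etuv _) = refl
  act-just-resp-Rel (pairEq _ _ _ _ _ _ equiv) = pair-resp (third-PairEquiv equiv)

  act-resp-Rel : ∀ {l r} → Rel E l r → ∀ m → act m l ≡ act m r
  act-resp-Rel ρ (just i) = act-just-resp-Rel ρ i
  act-resp-Rel {l} {r} ρ nothing = ≡.trans (act-nothing l) (≡.sym (act-nothing r))

  eval-++ : ∀ m (p q : List (Var k)) → act m (eval σ (p ++ q)) ≡ act (act m (eval σ p)) (eval σ q)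
  eval-++ m p q = ≡.trans (cong (act m) (concatMap-++ σ p q)) (foldl-++ _∙_ m (eval σ p) (eval σ q))

  block-fixes-e : ∀ tr → E (edgeOf tr) → act (just e) (eval σ (block tr)) ≡ just e
  block-fixes-e (u , v , w) uvw =
    ≡.trans (cong (λ m → act m (t ∷ vx u ∷ vx v ∷ vx w ∷ [])) (edge-act uvw et)) (edge-act uvw et)

  blocks-fix-e : ∀ {n} (ws : Fin n → Triple k) → (∀ i → E (edgeOf (ws i))) →
                 act (just e) (eval σ (pG-blocks ws)) ≡ just e
  blocks-fix-e {zero}  ws edges = refl
  blocks-fix-e {suc n} ws edges = begin
    act (just e) (eval σ (block (ws zero) ++ pG-blocks (ws ∘ suc)))   ≡⟨ eval-++ (just e) (block (ws zero)) (pG-blocks (ws ∘ suc)) ⟩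
    act (act (just e) (eval σ (block (ws zero)))) (eval σ (pG-blocks (ws ∘ suc)))
      ≡⟨ cong (λ m → act m (eval σ (pG-blocks (ws ∘ suc)))) (block-fixes-e (ws zero) (edges zero)) ⟩
    act (just e) (eval σ (pG-blocks (ws ∘ suc)))                       ≡⟨ blocks-fix-e (ws ∘ suc) (edges ∘ suc) ⟩
    just e                                                            ∎

  pG↦et : ∀ {n} {ws : Fin n → Triple k} → (∀ i → E (edgeOf (ws i))) →
          act (just e) (eval σ (pG ws)) ≡ just et
  pG↦et {ws = ws} edges = ≡.trans (eval-++ (just e) (pG-blocks ws) (y ∷ []))
                                  (cong (λ m → act m (t ∷ [])) (blocks-fix-e ws edges))

  et-annihilates-pG : ∀ {n} (ws : Fin n → Triple k) → act (just et) (eval σ (pG ws)) ≡ nothing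
  et-annihilates-pG {zero}  ws = refl
  et-annihilates-pG {suc n} ws = act-nothing (eval σ (drop 1 (pG ws)))

  pG²↦0 : ∀ {n} {ws : Fin n → Triple k} → (∀ i → E (edgeOf (ws i))) →
          act (just e) (eval σ (pG ws ++ pG ws)) ≡ nothing
  pG²↦0 {ws = ws} edges = begin
    act (just e) (eval σ (pG ws ++ pG ws))           ≡⟨ eval-++ (just e) (pG ws) (pG ws) ⟩
    act (act (just e) (eval σ (pG ws))) (eval σ (pG ws)) ≡⟨ cong (λ m → act m (eval σ (pG ws))) (pG↦et edges) ⟩
    act (just et) (eval σ (pG ws))                   ≡⟨ et-annihilates-pG ws ⟩
    nothing                                          ∎

lemma3p1 : (k : ℕ) (E : Edges k) → Decidable E →
    ThreeUniform E → GirthAtLeast4 E → NoIsolated E →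
    (n : ℕ) (ws : Fin n → Triple k) →
    CondAlpha E ws → CondBeta ws → CondGamma E ws →
    ¬ Satisfies E (pG ws) (pG ws ++ pG ws)
lemma3p1 k E E? uniform girth _ n ws α _ _ ⊨ = et≢0 $ begin
    just et                                ≡⟨ pG↦et edges ⟨
    act (just e) (eval σ (pG ws))          ≡⟨ foldl-resp-Cong _∙_ act-resp-Rel (⊨ σ) (just e) ⟩
    act (just e) (eval σ (pG ws ++ pG ws)) ≡⟨ pG²↦0 edges ⟩
    nothing                                ∎
  where
  open HyperedgeProperties E using (ThreeUniform⇒u≢v; girth≥4⇒third-unique)
  open RightIdeal E E? (ThreeUniform⇒u≢v uniform) (girth≥4⇒third-unique uniform girth)
  edges : ∀ i → E (edgeOf (ws i))
  edges i = Equivalence.to (α _ _ _) (i , refl)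
  et≢0 : just et ≢ nothing
  et≢0 ()
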